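{- Let $\mathbf z$ be the infinite fixed point, starting with $a$, of the morphism $h$ with $h(a)=aab$, $h(b)=b$, and define $f:\mathbb N\to\mathbb N$ by $f(i)=j$ whenever $2^{j+1}+j-2\le i\le 2^{j+2}+j-2$. Let $n\ge 0$. For each integer $t$ with $f(n)<t\le n$, there are exactly $n-t+1$ distinct factors of $\mathbf z$ of length $n$ whose longest $b$-run has length $t$.
   Context: A factor of an infinite word is a finite contiguous block of it. A $b$-run of a word $w$ is a maximal occurrence of a block of consecutive $b$'s in $w$ (not extendable within $w$ by a $b$ on either side); its length is its number of $b$'s. -}

module Defs where

open import Data.Nat using (ℕ; zero; suc; _+_; _∸_; _^_; _≤_; _⊔_)
open import Data.List using (List; []; _∷_; _++_; concatMap; length)
open import Data.Product using (_×_; ∃-syntax)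
open import Relation.Binary.PropositionalEquality using (_≡_)

data Letter : Set where
  a b : Letter

h₁ : Letter → List Letter
h₁ a = a ∷ a ∷ b ∷ []
h₁ b = b ∷ []

h : List Letter → List Letter
h = concatMap h₁

-- h^k(a); each is a prefix of the next, of length 2^(k+1) - 1.
hIter : ℕ → List Letter
hIter zero    = a ∷ []
hIter (suc k) = h (hIter k)

-- Safe lookup with default (never used at positions inside the word).
at : List Letter → ℕ → Letter
at []       _       = a
at (x ∷ w) zero    = x
at (x ∷ w) (suc i) = at w i

-- The infinite fixed point z = lim h^k(a): letter at position i is the
-- letter at position i of h^i(a), which has length 2^(i+1) - 1 > i.
z : ℕ → Letter
z i = at (hIter i) i

factorAt : ℕ → ℕ → List Letter
factorAt i zero    = []
factorAt i (suc n) = z i ∷ factorAt (suc i) n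

IsFactor : List Letter → Set
IsFactor w = ∃[ i ] factorAt i (length w) ≡ w

longestBRun-go : ℕ → ℕ → List Letter → ℕ
longestBRun-go cur best []      = best ⊔ cur
longestBRun-go cur best (b ∷ w) = longestBRun-go (suc cur) best w
longestBRun-go cur best (a ∷ w) = longestBRun-go 0 (best ⊔ cur) w

longestBRun : List Letter → ℕ
longestBRun = longestBRun-go 0 0

-- The function f : ℕ → ℕ, given as its graph: f(i) = j whenever
-- 2^(j+1) + j - 2 ≤ i ≤ 2^(j+2) + j - 2 (these intervals partition ℕ).
FGraph : ℕ → ℕ → Set
FGraph i j = (2 ^ (j + 1) + j ∸ 2 ≤ i) × (i ≤ 2 ^ (j + 2) + j ∸ 2)

Target : ℕ → ℕ → List Letter → Set
Target n t w = (length w ≡ n) × IsFactor w × (longestBRun w ≡ t)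

-- With A₀ = a and A_{k+1} = A_k b^k A_k one has h^k(a) = A_k b^k, so for t ≥ 1 the word z
-- is a concatenation of blocks A_t b^c with c ≥ t, while the b-runs inside A_t have length
-- at most t − 1. A factor of length n whose longest b-run has length t therefore takes that
-- run from a single separator; as t > f(n) gives n ≤ |A_t| + 2t − 1, what lies left of the run
-- is a suffix of ⋯bbb A_t and what lies right of it a prefix of A_t bbb⋯. So the factors are
-- exactly the words (suffix of length p) b^t (prefix of length q) with p + t + q = n; all of
-- them occur in z around the middle separator of A_{t+1}, and they are pairwise distinct
-- because p is where the first b-run of length t begins.

module Submission where

open import Defs
open import Data.Nat using (ℕ; zero; suc; _+_; _*_; _∸_; _^_; _≤_; _<_; _⊔_; z≤n; s≤s; s≤s⁻¹; _≟_)
open import Data.Nat.Tactic.RingSolver using (solve-∀)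
import Algebra.Solver.Monoid as MonoidSolver
open import Data.Nat.Properties
open import Data.List using (List; []; _∷_; _++_; length; replicate; take; drop; map; concat; tabulate)
open import Data.List.Properties
  using ( ++-assoc; ++-identityʳ; ++-monoid; length-++; length-replicate; length-drop; length-take
        ; length-tabulate; drop-all; drop-[]; take-all; map-++; concat-++)
open import Data.List.Membership.Propositional using (_∈_)
open import Data.List.Membership.Propositional.Properties using (∈-tabulate⁺; ∈-tabulate⁻)
open import Data.List.Relation.Unary.Unique.Propositional using (Unique)
open import Data.List.Relation.Unary.Unique.Propositional.Properties using (tabulate⁺)
open import Data.Fin using (Fin; toℕ; fromℕ<)
open import Data.Fin.Properties using (toℕ-injective; toℕ≤pred[n]; toℕ-fromℕ<)
open import Data.Product using (Σ; ∃; ∃₂; _×_; _,_; proj₁; proj₂)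
open import Data.Sum using (_⊎_; inj₁; inj₂)
open import Relation.Nullary using (contradiction; yes; no)
open import Data.Empty using (⊥; ⊥-elim)
open import Relation.Binary.PropositionalEquality
open import Relation.Binary.Definitions using (tri<; tri≈; tri>)

module _ {C : Set} where

  take-++-≤ : ∀ k (u v : List C) → k ≤ length u → take k (u ++ v) ≡ take k u
  take-++-≤ zero    u       v _         = refl
  take-++-≤ (suc k) (x ∷ u) v (s≤s k≤u) = cong (x ∷_) (take-++-≤ k u v k≤u)

  take-length-++ : ∀ k (u v : List C) → take (length u + k) (u ++ v) ≡ u ++ take k v
  take-length-++ k []      v = refl
  take-length-++ k (x ∷ u) v = cong (x ∷_) (take-length-++ k u v)

  drop-++-≤ : ∀ k (u v : List C) → k ≤ length u → drop k (u ++ v) ≡ drop k u ++ v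
  drop-++-≤ zero    u       v _         = refl
  drop-++-≤ (suc k) (x ∷ u) v (s≤s k≤u) = drop-++-≤ k u v k≤u

  ++-regroup : ∀ (x y u v : List C) → (x ++ y ++ u) ++ v ≡ (x ++ y) ++ u ++ v
  ++-regroup = solve 4 (λ x y u v → (x ⊕ y ⊕ u) ⊕ v ⊜ (x ⊕ y) ⊕ u ⊕ v) refl
    where open MonoidSolver (++-monoid C)

  drop-length-++ : ∀ k (u v : List C) → drop (length u + k) (u ++ v) ≡ drop k v
  drop-length-++ k []      v = refl
  drop-length-++ k (x ∷ u) v = drop-length-++ k u v

≤⊎≥ : ∀ m n → m ≤ n ⊎ ∃ λ g → m ≡ n + g
≤⊎≥ m n with ≤-total m n
... | inj₁ m≤n = inj₁ m≤n
... | inj₂ n≤m with m≤n⇒∃[o]m+o≡n n≤m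
...   | g , eq = inj₂ (g , sym eq)

⊔≡⇒≡ˡ : ∀ {x y m} → x ⊔ y ≡ m → y < m → x ≡ m
⊔≡⇒≡ˡ {x} {y} eq y<m with ⊔-sel x y
... | inj₁ x⊔y≡x = trans (sym x⊔y≡x) eq
... | inj₂ x⊔y≡y = contradiction (trans (sym x⊔y≡y) eq) (<⇒≢ y<m)

-- Longest b-runs

infix 10 b^_

b^_ : ℕ → List Letter
b^ k = replicate k b

length-b^ : ∀ k → length (b^ k) ≡ k
length-b^ k = length-replicate k

take-b^ : ∀ {k g} v → k ≤ g → take k (b^ g ++ v) ≡ b^ k
take-b^ {zero}          v _         = refl
take-b^ {suc k} {suc g} v (s≤s k≤g) = cong (b ∷_) (take-b^ v k≤g)

drop-b^ : ∀ k g v → drop k (b^ (k + g) ++ v) ≡ b^ g ++ v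
drop-b^ zero    g v = refl
drop-b^ (suc k) g v = drop-b^ k g v

drop-b^-++ : ∀ g k v → drop (g + k) (b^ g ++ v) ≡ drop k v
drop-b^-++ zero    k v = refl
drop-b^-++ (suc g) k v = drop-b^-++ g k v

take-drop-b^ : ∀ {i n g} v → i + n ≤ g → take n (drop i (b^ g ++ v)) ≡ b^ n
take-drop-b^ {i} {n} v i+n≤g with m≤n⇒∃[o]m+o≡n i+n≤g
... | r , refl = begin
  take n (drop i (b^ (i + n + r) ++ v))   ≡⟨ cong (λ k → take n (drop i (b^ k ++ v))) (+-assoc i n r) ⟩
  take n (drop i (b^ (i + (n + r)) ++ v)) ≡⟨ cong (take n) (drop-b^ i (n + r) v) ⟩
  take n (b^ (n + r) ++ v)                ≡⟨ take-b^ v (m≤m+n n r) ⟩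
  b^ n                                    ∎
  where open ≡-Reasoning

take-b^-++ : ∀ c k v → take (c + k) (b^ c ++ v) ≡ b^ c ++ take k v
take-b^-++ zero    k v = refl
take-b^-++ (suc c) k v = cong (b ∷_) (take-b^-++ c k v)

b^-suc-++ : ∀ k v → b^ (suc k) ++ v ≡ b^ k ++ b ∷ v
b^-suc-++ zero    v = refl
b^-suc-++ (suc k) v = cong (b ∷_) (b^-suc-++ k v)

data EndsWithA : List Letter → Set where
  [a] : EndsWithA (a ∷ [])
  _∷_ : ∀ x {u} → EndsWithA u → EndsWithA (x ∷ u)

data StartsWithA : List Letter → Set where
  a∷_ : ∀ v → StartsWithA (a ∷ v)

EndsWithA-++ : ∀ u {v} → EndsWithA v → EndsWithA (u ++ v)
EndsWithA-++ []      e = e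
EndsWithA-++ (x ∷ u) e = x ∷ EndsWithA-++ u e

StartsWithA-++ : ∀ {u} v → StartsWithA u → StartsWithA (u ++ v)
StartsWithA-++ v (a∷ u) = a∷ (u ++ v)

take-startsWithA : ∀ m {v} → StartsWithA v → StartsWithA (take (suc m) v)
take-startsWithA m (a∷ v) = a∷ take m v

-- If u is right-closed or v is left-closed, u ++ v cannot merge a b-run of u with one of v.
RightClosed : List Letter → Set
RightClosed u = u ≡ [] ⊎ EndsWithA u

LeftClosed : List Letter → Set
LeftClosed v = v ≡ [] ⊎ StartsWithA v

drop-rightClosed : ∀ k {u} → EndsWithA u → RightClosed (drop k u)
drop-rightClosed zero    e       = inj₂ e
drop-rightClosed (suc k) [a]     = inj₁ (drop-[] k)
drop-rightClosed (suc k) (x ∷ e) = drop-rightClosed k e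

go-++-a∷ : ∀ u c m v → longestBRun-go c m (u ++ a ∷ v) ≡ longestBRun-go 0 (longestBRun-go c m u) v
go-++-a∷ []      c m v = refl
go-++-a∷ (a ∷ u) c m v = go-++-a∷ u 0 (m ⊔ c) v
go-++-a∷ (b ∷ u) c m v = go-++-a∷ u (suc c) m v

go-++-endsWithA : ∀ {u} → EndsWithA u → ∀ c m v →
                  longestBRun-go c m (u ++ v) ≡ longestBRun-go 0 (longestBRun-go c m u) v
go-++-endsWithA [a]     c m v = cong (λ x → longestBRun-go 0 x v) (sym (⊔-identityʳ (m ⊔ c)))
go-++-endsWithA (a ∷ e) c m v = go-++-endsWithA e 0 (m ⊔ c) v
go-++-endsWithA (b ∷ e) c m v = go-++-endsWithA e (suc c) m v

go-⊔ : ∀ c m v → longestBRun-go c m v ≡ m ⊔ longestBRun-go c 0 v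
go-⊔ c m []      = refl
go-⊔ c m (a ∷ v) = begin
  longestBRun-go 0 (m ⊔ c) v           ≡⟨ go-⊔ 0 (m ⊔ c) v ⟩
  m ⊔ c ⊔ longestBRun-go 0 0 v         ≡⟨ ⊔-assoc m c _ ⟩
  m ⊔ (c ⊔ longestBRun-go 0 0 v)       ≡⟨ cong (m ⊔_) (go-⊔ 0 c v) ⟨
  m ⊔ longestBRun-go 0 c v             ∎
  where open ≡-Reasoning
go-⊔ c m (b ∷ v) = go-⊔ (suc c) m v

go-b^ : ∀ c m k → longestBRun-go c m (b^ k) ≡ m ⊔ (k + c)
go-b^ c m zero    = refl
go-b^ c m (suc k) = trans (go-b^ (suc c) m k) (cong (m ⊔_) (+-suc k c))

go-mono : ∀ {c c′ m m′} v → c ≤ c′ → m ≤ m′ → longestBRun-go c m v ≤ longestBRun-go c′ m′ v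
go-mono []      c≤ m≤ = ⊔-mono-≤ m≤ c≤
go-mono (a ∷ v) c≤ m≤ = go-mono v z≤n (⊔-mono-≤ m≤ c≤)
go-mono (b ∷ v) c≤ m≤ = go-mono v (s≤s c≤) m≤

go-≥ : ∀ c m v → m ⊔ c ≤ longestBRun-go c m v
go-≥ c m []      = ≤-refl
go-≥ c m (a ∷ v) = ≤-trans (≤-reflexive (sym (⊔-identityʳ (m ⊔ c)))) (go-≥ 0 (m ⊔ c) v)
go-≥ c m (b ∷ v) = ≤-trans (⊔-monoʳ-≤ m (n≤1+n c)) (go-≥ (suc c) m v)

go-take : ∀ k c m v → longestBRun-go c m (take k v) ≤ longestBRun-go c m v
go-take zero    c m v       = go-≥ c m v
go-take (suc k) c m []      = ≤-refl
go-take (suc k) c m (a ∷ v) = go-take k 0 (m ⊔ c) v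
go-take (suc k) c m (b ∷ v) = go-take k (suc c) m v

go-drop : ∀ k c m v → longestBRun-go 0 0 (drop k v) ≤ longestBRun-go c m v
go-drop zero    c m v       = go-mono v z≤n z≤n
go-drop (suc k) c m []      = z≤n
go-drop (suc k) c m (a ∷ v) = go-drop k 0 (m ⊔ c) v
go-drop (suc k) c m (b ∷ v) = go-drop k (suc c) m v

longestBRun-++-a∷ : ∀ u v → longestBRun (u ++ a ∷ v) ≡ longestBRun u ⊔ longestBRun v
longestBRun-++-a∷ u v = trans (go-++-a∷ u 0 0 v) (go-⊔ 0 (longestBRun u) v)

longestBRun-++ʳ : ∀ {u} v → RightClosed u → longestBRun (u ++ v) ≡ longestBRun u ⊔ longestBRun v
longestBRun-++ʳ     v (inj₁ refl) = refl
longestBRun-++ʳ {u} v (inj₂ e)    = trans (go-++-endsWithA e 0 0 v) (go-⊔ 0 (longestBRun u) v)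

longestBRun-++ˡ : ∀ u {v} → LeftClosed v → longestBRun (u ++ v) ≡ longestBRun u ⊔ longestBRun v
longestBRun-++ˡ u (inj₁ refl)    = trans (cong longestBRun (++-identityʳ u)) (sym (⊔-identityʳ _))
longestBRun-++ˡ u (inj₂ (a∷ v)) = longestBRun-++-a∷ u v

longestBRun-b^ : ∀ k → longestBRun (b^ k) ≡ k
longestBRun-b^ k = trans (go-b^ 0 0 k) (+-identityʳ k)

longestBRun-b^-++ : ∀ k {v} → LeftClosed v → longestBRun (b^ k ++ v) ≡ k ⊔ longestBRun v
longestBRun-b^-++ k v-closed = trans (longestBRun-++ˡ (b^ k) v-closed) (cong (_⊔ _) (longestBRun-b^ k))

longestBRun-++-b^ : ∀ {u} k → RightClosed u → longestBRun (u ++ b^ k) ≡ longestBRun u ⊔ k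
longestBRun-++-b^ {u} k u-closed = trans (longestBRun-++ʳ (b^ k) u-closed) (cong (longestBRun u ⊔_) (longestBRun-b^ k))

longestBRun-take : ∀ k v → longestBRun (take k v) ≤ longestBRun v
longestBRun-take k = go-take k 0 0

longestBRun-drop : ∀ k v → longestBRun (drop k v) ≤ longestBRun v
longestBRun-drop k = go-drop k 0 0

-- The words A k and the fixed point z

A : ℕ → List Letter
A zero    = a ∷ []
A (suc k) = A k ++ b^ k ++ A k

A-startsWithA : ∀ k → StartsWithA (A k)
A-startsWithA zero    = a∷ []
A-startsWithA (suc k) = StartsWithA-++ (b^ k ++ A k) (A-startsWithA k)

A-endsWithA : ∀ k → EndsWithA (A k)
A-endsWithA zero    = [a]
A-endsWithA (suc k) = EndsWithA-++ (A k) (EndsWithA-++ (b^ k) (A-endsWithA k))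

longestBRun-A : ∀ k → longestBRun (A k) ≡ k ∸ 1
longestBRun-A zero    = refl
longestBRun-A (suc k) = begin
  longestBRun (A k ++ b^ k ++ A k)
    ≡⟨ longestBRun-++ʳ (b^ k ++ A k) (inj₂ (A-endsWithA k)) ⟩
  longestBRun (A k) ⊔ longestBRun (b^ k ++ A k)
    ≡⟨ cong (longestBRun (A k) ⊔_) (longestBRun-++ˡ (b^ k) (inj₂ (A-startsWithA k))) ⟩
  longestBRun (A k) ⊔ (longestBRun (b^ k) ⊔ longestBRun (A k))
    ≡⟨ cong₂ (λ x y → x ⊔ (y ⊔ x)) (longestBRun-A k) (longestBRun-b^ k) ⟩
  (k ∸ 1) ⊔ (k ⊔ (k ∸ 1))
    ≡⟨ cong ((k ∸ 1) ⊔_) (m≥n⇒m⊔n≡m (m∸n≤m k 1)) ⟩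
  (k ∸ 1) ⊔ k
    ≡⟨ m≤n⇒m⊔n≡n (m∸n≤m k 1) ⟩
  k ∎
  where open ≡-Reasoning

length-A : ∀ k → length (A k) + suc k ≡ 2 ^ suc k
length-A zero    = refl
length-A (suc k) = begin
  length (A k ++ b^ k ++ A k) + suc (suc k)     ≡⟨ cong (_+ suc (suc k)) length-A[suc] ⟩
  length (A k) + (k + length (A k)) + suc (suc k) ≡⟨ double (length (A k)) k ⟩
  2 * (length (A k) + suc k)                     ≡⟨ cong (2 *_) (length-A k) ⟩
  2 ^ suc (suc k)                                ∎
  where
  open ≡-Reasoning
  length-A[suc] : length (A k ++ b^ k ++ A k) ≡ length (A k) + (k + length (A k))
  length-A[suc] = trans (length-++ (A k)) (cong (length (A k) +_)
                    (trans (length-++ (b^ k)) (cong (_+ length (A k)) (length-b^ k))))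
  double : ∀ x y → x + (y + x) + suc (suc y) ≡ 2 * (x + suc y)
  double = solve-∀

1≤length-A : ∀ k → 1 ≤ length (A k)
1≤length-A k with A k | A-startsWithA k
... | _ | a∷ _ = s≤s z≤n

h-++ : ∀ u v → h (u ++ v) ≡ h u ++ h v
h-++ u v = trans (cong concat (map-++ h₁ u v)) (sym (concat-++ (map h₁ u) (map h₁ v)))

h-b^ : ∀ k → h (b^ k) ≡ b^ k
h-b^ zero    = refl
h-b^ (suc k) = cong (b ∷_) (h-b^ k)

h-A++b^ : ∀ k m → h (A k ++ b^ m) ≡ A (suc k) ++ b^ (suc m)
h-A++b^ zero    m = cong (λ w → a ∷ a ∷ b ∷ w) (h-b^ m)
h-A++b^ (suc k) m = begin
  h ((A k ++ b^ k ++ A k) ++ b^ m)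
    ≡⟨ cong h (++-regroup (A k) (b^ k) (A k) (b^ m)) ⟩
  h ((A k ++ b^ k) ++ A k ++ b^ m)
    ≡⟨ h-++ (A k ++ b^ k) (A k ++ b^ m) ⟩
  h (A k ++ b^ k) ++ h (A k ++ b^ m)
    ≡⟨ cong₂ _++_ (h-A++b^ k k) (h-A++b^ k m) ⟩
  (A (suc k) ++ b^ (suc k)) ++ A (suc k) ++ b^ (suc m)
    ≡⟨ ++-regroup (A (suc k)) (b^ (suc k)) (A (suc k)) (b^ (suc m)) ⟨
  A (suc (suc k)) ++ b^ (suc m) ∎
  where open ≡-Reasoning

hIter≡A++b^ : ∀ k → hIter k ≡ A k ++ b^ k
hIter≡A++b^ zero    = refl
hIter≡A++b^ (suc k) = trans (cong h (hIter≡A++b^ k)) (h-A++b^ k k)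

hIter-suc : ∀ k → hIter (suc k) ≡ hIter k ++ A k ++ b^ (suc k)
hIter-suc k = begin
  hIter (suc k)                          ≡⟨ hIter≡A++b^ (suc k) ⟩
  (A k ++ b^ k ++ A k) ++ b^ (suc k)     ≡⟨ ++-regroup (A k) (b^ k) (A k) (b^ (suc k)) ⟩
  (A k ++ b^ k) ++ A k ++ b^ (suc k)     ≡⟨ cong (_++ A k ++ b^ (suc k)) (hIter≡A++b^ k) ⟨
  hIter k ++ A k ++ b^ (suc k)           ∎
  where open ≡-Reasoning

hIter-prefix : ∀ d k → ∃ λ Y → hIter (d + k) ≡ hIter k ++ Y
hIter-prefix zero    k = [] , sym (++-identityʳ (hIter k))
hIter-prefix (suc d) k with hIter-prefix d k
... | Y , eq = Y ++ A (d + k) ++ b^ (suc (d + k)) ,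
               trans (hIter-suc (d + k)) (trans (cong (_++ _) eq) (++-assoc (hIter k) Y _))

length-hIter : ∀ k → suc k ≤ length (hIter k)
length-hIter k rewrite hIter≡A++b^ k | length-++ (A k) {b^ k} | length-b^ k = +-monoˡ-≤ k (1≤length-A k)

at-++ : ∀ X Y {m} → m < length X → at (X ++ Y) m ≡ at X m
at-++ (x ∷ X) Y {zero}  _         = refl
at-++ (x ∷ X) Y {suc m} (s≤s m<X) = at-++ X Y m<X

drop-at : ∀ X {i} → i < length X → drop i X ≡ at X i ∷ drop (suc i) X
drop-at (x ∷ X) {zero}  _         = refl
drop-at (x ∷ X) {suc i} (s≤s i<X) = drop-at X i<X

z≡at-hIter : ∀ {m K} → m ≤ K → z m ≡ at (hIter K) m
z≡at-hIter {m} m≤K with m≤n⇒∃[o]m+o≡n m≤K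
... | d , refl with hIter-prefix d m
... | Y , eq = begin
  at (hIter m) m            ≡⟨ at-++ (hIter m) Y (length-hIter m) ⟨
  at (hIter m ++ Y) m       ≡⟨ cong (λ w → at w m) eq ⟨
  at (hIter (d + m)) m      ≡⟨ cong (λ k → at (hIter k) m) (+-comm d m) ⟩
  at (hIter (m + d)) m      ∎
  where open ≡-Reasoning

factorAt≡take-drop-hIter : ∀ {i K} n → i + n ≤ suc K → factorAt i n ≡ take n (drop i (hIter K))
factorAt≡take-drop-hIter         zero    _   = refl
factorAt≡take-drop-hIter {i} {K} (suc n) bnd = begin
  z i ∷ factorAt (suc i) n
    ≡⟨ cong₂ _∷_ (z≡at-hIter i≤K) (factorAt≡take-drop-hIter n bnd′) ⟩
  at (hIter K) i ∷ take n (drop (suc i) (hIter K))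
    ≡⟨ cong (take (suc n)) (drop-at (hIter K) (≤-trans (s≤s i≤K) (length-hIter K))) ⟨
  take (suc n) (drop i (hIter K)) ∎
  where
  open ≡-Reasoning
  bnd′ : suc i + n ≤ suc K
  bnd′ = ≤-trans (≤-reflexive (sym (+-suc i n))) bnd
  i≤K : i ≤ K
  i≤K = s≤s⁻¹ (≤-trans (m≤m+n (suc i) n) bnd′)

-- Factors whose longest b-run has length t = suc s

module FixedRunLength (s : ℕ) where

  t : ℕ
  t = suc s

  L : ℕ
  L = length (A t)

  longestBRun-At : longestBRun (A t) ≡ s
  longestBRun-At = longestBRun-A t

  ≡t⇒≰s : ∀ {x} → x ≡ t → x ≤ s → ⊥
  ≡t⇒≰s refl = 1+n≰n

  -- suffixA p is the length-p suffix of the left-infinite word ⋯bbb A t,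
  -- prefixA q the length-q prefix of the right-infinite word A t bbb⋯.
  suffixA : ℕ → List Letter
  suffixA p = b^ (p ∸ L) ++ drop (L ∸ p) (A t)

  prefixA : ℕ → List Letter
  prefixA q = take q (A t) ++ b^ (q ∸ L)

  W : ℕ → ℕ → List Letter
  W p q = suffixA p ++ b^ t ++ prefixA q

  suffixA-≤ : ∀ {p} → p ≤ L → suffixA p ≡ drop (L ∸ p) (A t)
  suffixA-≤ p≤L rewrite m≤n⇒m∸n≡0 p≤L = refl

  suffixA-+ : ∀ g → suffixA (L + g) ≡ b^ g ++ A t
  suffixA-+ g rewrite m+n∸m≡n L g | m≤n⇒m∸n≡0 (m≤m+n L g) = refl

  suffixA-0 : suffixA 0 ≡ []
  suffixA-0 rewrite 0∸n≡0 L = drop-all L (A t) ≤-refl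

  prefixA-≤ : ∀ {q} → q ≤ L → prefixA q ≡ take q (A t)
  prefixA-≤ {q} q≤L rewrite m≤n⇒m∸n≡0 q≤L = ++-identityʳ (take q (A t))

  prefixA-+ : ∀ g → prefixA (L + g) ≡ A t ++ b^ g
  prefixA-+ g rewrite m+n∸m≡n L g = cong (_++ b^ g) (take-all (L + g) (A t) (m≤m+n L g))

  prefixA-0 : prefixA 0 ≡ []
  prefixA-0 = cong b^_ (0∸n≡0 L)

  W-0-q : ∀ q → W 0 q ≡ b^ t ++ prefixA q
  W-0-q q = cong (_++ b^ t ++ prefixA q) suffixA-0

  W-p-0 : ∀ p → W p 0 ≡ suffixA p ++ b^ t
  W-p-0 p = trans (cong (λ x → suffixA p ++ b^ t ++ x) prefixA-0) (cong (suffixA p ++_) (++-identityʳ (b^ t)))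

  length-suffixA : ∀ p → length (suffixA p) ≡ p
  length-suffixA p with ≤⊎≥ p L
  ... | inj₁ p≤L rewrite suffixA-≤ p≤L = trans (length-drop (L ∸ p) (A t)) (m∸[m∸n]≡n p≤L)
  ... | inj₂ (g , refl) rewrite suffixA-+ g =
    trans (length-++ (b^ g)) (trans (cong (_+ L) (length-b^ g)) (+-comm g L))

  length-prefixA : ∀ q → length (prefixA q) ≡ q
  length-prefixA q with ≤⊎≥ q L
  ... | inj₁ q≤L rewrite prefixA-≤ q≤L = trans (length-take q (A t)) (m≤n⇒m⊓n≡m q≤L)
  ... | inj₂ (g , refl) rewrite prefixA-+ g = trans (length-++ (A t)) (cong (L +_) (length-b^ g))

  suffixA-rightClosed : ∀ p → RightClosed (suffixA p)
  suffixA-rightClosed p with ≤⊎≥ p L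
  ... | inj₁ p≤L rewrite suffixA-≤ p≤L = drop-rightClosed (L ∸ p) (A-endsWithA t)
  ... | inj₂ (g , refl) rewrite suffixA-+ g = inj₂ (EndsWithA-++ (b^ g) (A-endsWithA t))

  prefixA-leftClosed : ∀ q → LeftClosed (prefixA q)
  prefixA-leftClosed zero    = inj₁ prefixA-0
  prefixA-leftClosed (suc m) = inj₂ (StartsWithA-++ _ (take-startsWithA m (A-startsWithA t)))

  longestBRun-b^++At : ∀ g → longestBRun (b^ g ++ A t) ≡ g ⊔ s
  longestBRun-b^++At g = trans (longestBRun-b^-++ g (inj₂ (A-startsWithA t))) (cong (g ⊔_) longestBRun-At)

  longestBRun-suffixA : ∀ {p} → p ≤ L + s → longestBRun (suffixA p) ≤ s
  longestBRun-suffixA {p} p≤ with ≤⊎≥ p L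
  ... | inj₁ p≤L rewrite suffixA-≤ p≤L = ≤-trans (longestBRun-drop (L ∸ p) (A t)) (≤-reflexive longestBRun-At)
  ... | inj₂ (g , refl) rewrite suffixA-+ g =
    ≤-trans (≤-reflexive (longestBRun-b^++At g)) (⊔-lub (+-cancelˡ-≤ L g s p≤) ≤-refl)

  longestBRun-prefixA : ∀ {q} → q ≤ L + t → longestBRun (prefixA q) ≤ t
  longestBRun-prefixA {q} q≤ with ≤⊎≥ q L
  ... | inj₁ q≤L rewrite prefixA-≤ q≤L =
    ≤-trans (longestBRun-take q (A t)) (≤-trans (≤-reflexive longestBRun-At) (n≤1+n s))
  ... | inj₂ (g , refl) rewrite prefixA-+ g =
    ≤-trans (≤-reflexive (trans (longestBRun-++-b^ g (inj₂ (A-endsWithA t))) (cong (_⊔ g) longestBRun-At)))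
            (⊔-lub (n≤1+n s) (+-cancelˡ-≤ L g t q≤))

  longestBRun-prefixA-≤L : ∀ {q} → q ≤ L → longestBRun (prefixA q) ≤ s
  longestBRun-prefixA-≤L {q} q≤L = begin
    longestBRun (prefixA q)        ≡⟨ cong longestBRun (prefixA-≤ q≤L) ⟩
    longestBRun (take q (A t))     ≤⟨ longestBRun-take q (A t) ⟩
    longestBRun (A t)              ≡⟨ longestBRun-At ⟩
    s                              ∎
    where open ≤-Reasoning

  longestBRun-suffixA≡t : ∀ {d} → longestBRun (suffixA d) ≡ t → d ≡ L + t
  longestBRun-suffixA≡t {d} run≡t with ≤⊎≥ d L
  ... | inj₁ d≤L = ⊥-elim (≡t⇒≰s run≡t (longestBRun-suffixA (≤-trans d≤L (m≤m+n L s))))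
  ... | inj₂ (g , refl) = cong (L +_) (⊔≡⇒≡ˡ g⊔s≡t ≤-refl)
    where
    g⊔s≡t : g ⊔ s ≡ t
    g⊔s≡t = trans (sym (longestBRun-b^++At g)) (trans (cong longestBRun (sym (suffixA-+ g))) run≡t)

  longestBRun-W : ∀ {p q} → p ≤ L + s → q ≤ L + t → longestBRun (W p q) ≡ t
  longestBRun-W {p} {q} p≤ q≤ = begin
    longestBRun (suffixA p ++ b^ t ++ prefixA q)
      ≡⟨ longestBRun-++ʳ _ (suffixA-rightClosed p) ⟩
    longestBRun (suffixA p) ⊔ longestBRun (b^ t ++ prefixA q)
      ≡⟨ cong (longestBRun (suffixA p) ⊔_) (longestBRun-b^-++ t (prefixA-leftClosed q)) ⟩
    longestBRun (suffixA p) ⊔ (t ⊔ longestBRun (prefixA q))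
      ≡⟨ cong (longestBRun (suffixA p) ⊔_) (m≥n⇒m⊔n≡m (longestBRun-prefixA q≤)) ⟩
    longestBRun (suffixA p) ⊔ t
      ≡⟨ m≤n⇒m⊔n≡n (≤-trans (longestBRun-suffixA p≤) (n≤1+n s)) ⟩
    t ∎
    where open ≡-Reasoning

  length-W : ∀ p q → length (W p q) ≡ p + t + q
  length-W p q = begin
    length (suffixA p ++ b^ t ++ prefixA q)
      ≡⟨ length-++ (suffixA p) ⟩
    length (suffixA p) + length (b^ t ++ prefixA q)
      ≡⟨ cong₂ _+_ (length-suffixA p) (length-++ (b^ t)) ⟩
    p + (length (b^ t) + length (prefixA q))
      ≡⟨ cong₂ (λ x y → p + (x + y)) (length-b^ t) (length-prefixA q) ⟩
    p + (t + q)
      ≡⟨ +-assoc p t q ⟨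
    p + t + q ∎
    where open ≡-Reasoning

  take-suffixA-++ : ∀ p k v → take (p + k) (suffixA p ++ v) ≡ suffixA p ++ take k v
  take-suffixA-++ p k v = subst (λ x → take (x + k) (suffixA p ++ v) ≡ suffixA p ++ take k v)
                                (length-suffixA p) (take-length-++ k (suffixA p) v)

  take-suffixA++b^t : ∀ {p q n} R → p + t + q ≡ n → take q R ≡ prefixA q →
                      take n (suffixA p ++ b^ t ++ R) ≡ W p q
  take-suffixA++b^t {p} {q} {n} R refl take-R = begin
    take (p + t + q) (suffixA p ++ b^ t ++ R)
      ≡⟨ cong (λ k → take k (suffixA p ++ b^ t ++ R)) (+-assoc p t q) ⟩
    take (p + (t + q)) (suffixA p ++ b^ t ++ R)
      ≡⟨ take-suffixA-++ p (t + q) (b^ t ++ R) ⟩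
    suffixA p ++ take (t + q) (b^ t ++ R)
      ≡⟨ cong (suffixA p ++_) (take-b^-++ t q R) ⟩
    suffixA p ++ b^ t ++ take q R
      ≡⟨ cong (λ x → suffixA p ++ b^ t ++ x) take-R ⟩
    W p q ∎
    where open ≡-Reasoning

  longestBRun-take-W : ∀ {p} q → p ≤ L + s → longestBRun (take (p + t) (W p q)) ≡ t
  longestBRun-take-W {p} q p≤ = begin
    longestBRun (take (p + t) (W p q))
      ≡⟨ cong longestBRun (take-suffixA-++ p t (b^ t ++ prefixA q)) ⟩
    longestBRun (suffixA p ++ take t (b^ t ++ prefixA q))
      ≡⟨ cong (λ x → longestBRun (suffixA p ++ x)) (take-b^ (prefixA q) ≤-refl) ⟩
    longestBRun (suffixA p ++ b^ t)
      ≡⟨ longestBRun-++-b^ t (suffixA-rightClosed p) ⟩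
    longestBRun (suffixA p) ⊔ t
      ≡⟨ m≤n⇒m⊔n≡n (≤-trans (longestBRun-suffixA p≤) (n≤1+n s)) ⟩
    t ∎
    where open ≡-Reasoning

  longestBRun-take-W-< : ∀ {p p′} q′ → p < p′ → p′ ≤ L + s → longestBRun (take (p + t) (W p′ q′)) ≤ s
  longestBRun-take-W-< {p} {p′} q′ p<p′ p′≤ = begin
    longestBRun (take (p + t) (W p′ q′))
      ≡⟨ cong (λ w → longestBRun (take (p + t) w)) W-split ⟩
    longestBRun (take (p + t) ((suffixA p′ ++ b^ s) ++ b ∷ prefixA q′))
      ≡⟨ cong longestBRun (take-++-≤ (p + t) _ _ p+t≤) ⟩
    longestBRun (take (p + t) (suffixA p′ ++ b^ s))
      ≤⟨ longestBRun-take (p + t) _ ⟩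
    longestBRun (suffixA p′ ++ b^ s)
      ≡⟨ longestBRun-++-b^ s (suffixA-rightClosed p′) ⟩
    longestBRun (suffixA p′) ⊔ s
      ≤⟨ ⊔-lub (longestBRun-suffixA p′≤) ≤-refl ⟩
    s ∎
    where
    open ≤-Reasoning
    W-split : W p′ q′ ≡ (suffixA p′ ++ b^ s) ++ b ∷ prefixA q′
    W-split = trans (cong (suffixA p′ ++_) (b^-suc-++ s (prefixA q′))) (sym (++-assoc (suffixA p′) (b^ s) _))
    p+t≤ : p + t ≤ length (suffixA p′ ++ b^ s)
    p+t≤ = ≤-trans (≤-trans (≤-reflexive (+-suc p s)) (+-monoˡ-≤ s p<p′))
                   (≤-reflexive (sym (trans (length-++ (suffixA p′)) (cong₂ _+_ (length-suffixA p′) (length-b^ s)))))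

  -- p is recovered from W p q as the least p whose first p + t letters contain a b-run of length t.
  W-injectiveˡ : ∀ {p q p′ q′} → p ≤ L + s → p′ ≤ L + s → W p q ≡ W p′ q′ → p ≡ p′
  W-injectiveˡ {p} {q} {p′} {q′} p≤ p′≤ eq with <-cmp p p′
  ... | tri≈ _ p≡p′ _ = p≡p′
  ... | tri< p<p′ _ _ = ⊥-elim (≡t⇒≰s (longestBRun-take-W q p≤)
                          (subst (λ w → longestBRun (take (p + t) w) ≤ s) (sym eq) (longestBRun-take-W-< q′ p<p′ p′≤)))
  ... | tri> _ _ p′<p = ⊥-elim (≡t⇒≰s (longestBRun-take-W q′ p′≤)
                          (subst (λ w → longestBRun (take (p′ + t) w) ≤ s) eq (longestBRun-take-W-< q p′<p p≤)))

  take-At++b^ : ∀ {q c} Y → q ≤ L + c → take q (A t ++ b^ c ++ Y) ≡ prefixA q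
  take-At++b^ {q} {c} Y q≤ with ≤⊎≥ q L
  ... | inj₁ q≤L = trans (take-++-≤ q (A t) _ q≤L) (sym (prefixA-≤ q≤L))
  ... | inj₂ (g , refl) = begin
    take (L + g) (A t ++ b^ c ++ Y)   ≡⟨ take-length-++ g (A t) (b^ c ++ Y) ⟩
    A t ++ take g (b^ c ++ Y)         ≡⟨ cong (A t ++_) (take-b^ Y (+-cancelˡ-≤ L g c q≤)) ⟩
    A t ++ b^ g                       ≡⟨ prefixA-+ g ⟨
    prefixA (L + g)                   ∎
    where open ≡-Reasoning

  drop-b^++At++ : ∀ {i} g v → i ≤ g + L → drop i (b^ g ++ A t ++ v) ≡ suffixA (g + L ∸ i) ++ v
  drop-b^++At++ {i} g v i≤ with ≤⊎≥ i g
  ... | inj₁ i≤g with m≤n⇒∃[o]m+o≡n i≤g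
  ...   | k , refl = begin
    drop i (b^ (i + k) ++ A t ++ v)
      ≡⟨ drop-b^ i k (A t ++ v) ⟩
    b^ k ++ A t ++ v
      ≡⟨ ++-assoc (b^ k) (A t) v ⟨
    (b^ k ++ A t) ++ v
      ≡⟨ cong (_++ v) (suffixA-+ k) ⟨
    suffixA (L + k) ++ v
      ≡⟨ cong (λ x → suffixA x ++ v) (trans (+-comm L k) (sym (m+n∸m≡n i (k + L)))) ⟩
    suffixA (i + (k + L) ∸ i) ++ v
      ≡⟨ cong (λ x → suffixA (x ∸ i) ++ v) (+-assoc i k L) ⟨
    suffixA (i + k + L ∸ i) ++ v ∎
    where open ≡-Reasoning
  drop-b^++At++ g v i≤ | inj₂ (k , refl) = begin
    drop (g + k) (b^ g ++ A t ++ v)   ≡⟨ drop-b^-++ g k (A t ++ v) ⟩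
    drop k (A t ++ v)                 ≡⟨ drop-++-≤ k (A t) v k≤L ⟩
    drop k (A t) ++ v                 ≡⟨ cong (λ x → drop x (A t) ++ v) (m∸[m∸n]≡n k≤L) ⟨
    drop (L ∸ (L ∸ k)) (A t) ++ v     ≡⟨ cong (_++ v) (suffixA-≤ (m∸n≤m L k)) ⟨
    suffixA (L ∸ k) ++ v              ≡⟨ cong (λ x → suffixA x ++ v) ([m+n]∸[m+o]≡n∸o g L k) ⟨
    suffixA (g + L ∸ (g + k)) ++ v    ∎
    where
    open ≡-Reasoning
    k≤L : k ≤ L
    k≤L = +-cancelˡ-≤ g k L i≤

  -- z contains b^(t+1) A t b^t A t b^(t+2), and W p q sits around the middle b^t.
  W-isFactor : ∀ {p q} → p ≤ L + t → q ≤ L + t → IsFactor (W p q)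
  W-isFactor {p} {q} p≤ q≤ = i , (begin
    factorAt i (length (W p q))
      ≡⟨ cong (factorAt i) (length-W p q) ⟩
    factorAt i n
      ≡⟨ factorAt≡take-drop-hIter n (≤-trans (m≤m+n (i + n) K₀) (n≤1+n _)) ⟩
    take n (drop i (hIter (i + n + K₀)))
      ≡⟨ cong (λ w → take n (drop i w)) (trans hIter≡ layout) ⟩
    take n (drop i (A (suc t) ++ b^ (suc t) ++ A t ++ b^ t ++ R))
      ≡⟨ cong (take n) (drop-length-++ _ (A (suc t)) _) ⟩
    take n (drop (suc t + L ∸ p) (b^ (suc t) ++ A t ++ b^ t ++ R))
      ≡⟨ cong (take n) (drop-b^++At++ (suc t) _ (m∸n≤m _ p)) ⟩
    take n (suffixA (suc t + L ∸ (suc t + L ∸ p)) ++ b^ t ++ R)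
      ≡⟨ cong (λ x → take n (suffixA x ++ b^ t ++ R)) (m∸[m∸n]≡n p≤1+t+L) ⟩
    take n (suffixA p ++ b^ t ++ R)
      ≡⟨ take-suffixA++b^t R refl (take-At++b^ Y q≤L+K₀) ⟩
    W p q ∎)
    where
    open ≡-Reasoning
    n = p + t + q
    K₀ = suc (suc t)
    i = length (A (suc t)) + (suc t + L ∸ p)
    Y = proj₁ (hIter-prefix (i + n) K₀)
    hIter≡ = proj₂ (hIter-prefix (i + n) K₀)
    R = A t ++ b^ K₀ ++ Y
    layout : hIter K₀ ++ Y ≡ A (suc t) ++ b^ (suc t) ++ A t ++ b^ t ++ R
    layout = trans (cong (_++ Y) (hIter≡A++b^ K₀))
      (solve 6 (λ P B X T C Y → ((P ⊕ B ⊕ (X ⊕ T ⊕ X)) ⊕ C) ⊕ Y ⊜ P ⊕ B ⊕ X ⊕ T ⊕ X ⊕ C ⊕ Y) refl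
             (A (suc t)) (b^ (suc t)) (A t) (b^ t) (b^ K₀) Y)
      where open MonoidSolver (++-monoid Letter)
    p≤1+t+L : p ≤ suc t + L
    p≤1+t+L = ≤-trans p≤ (≤-trans (≤-reflexive (+-comm L t)) (n≤1+n (t + L)))
    q≤L+K₀ : q ≤ L + K₀
    q≤L+K₀ = ≤-trans q≤ (+-monoʳ-≤ L (≤-trans (n≤1+n t) (n≤1+n (suc t))))

  W-bounds : ∀ {p q} → p + t + q ≤ L + s + t → p ≤ L + s × q ≤ L + s
  W-bounds {p} {q} bound = +-cancelʳ-≤ t p (L + s) (≤-trans (m≤m+n (p + t) q) bound)
                         , +-cancelʳ-≤ t q (L + s) (≤-trans q+t≤ bound)
    where
    q+t≤ : q + t ≤ p + t + q
    q+t≤ = begin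
      q + t         ≡⟨ +-comm q t ⟩
      t + q         ≤⟨ m≤n+m (t + q) p ⟩
      p + (t + q)   ≡⟨ +-assoc p t q ⟨
      p + t + q     ∎
      where open ≤-Reasoning

  Target-W : ∀ {p q} → p + t + q ≤ L + s + t → Target (p + t + q) t (W p q)
  Target-W {p} {q} bound =
    length-W p q , W-isFactor (≤-trans p≤ L+s≤L+t) (≤-trans q≤ L+s≤L+t) , longestBRun-W p≤ (≤-trans q≤ L+s≤L+t)
    where
    p≤ = proj₁ (W-bounds bound)
    q≤ = proj₂ (W-bounds bound)
    L+s≤L+t : L + s ≤ L + t
    L+s≤L+t = +-monoʳ-≤ L (n≤1+n s)

  data Tiled : List Letter → Set where
    []   : Tiled []
    tile : ∀ {c X} → t ≤ c → Tiled X → Tiled (A t ++ b^ c ++ X)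

  tiled-A++b^ : ∀ d {c Y} → t ≤ c → Tiled Y → Tiled (A (d + t) ++ b^ c ++ Y)
  tiled-A++b^ zero    t≤c tY = tile t≤c tY
  tiled-A++b^ (suc d) {c} {Y} t≤c tY =
    subst Tiled (sym (trans (++-assoc (A k) _ _) (cong (A k ++_) (++-assoc (b^ k) (A k) _))))
          (tiled-A++b^ d (m≤n+m t d) (tiled-A++b^ d t≤c tY))
    where k = d + t

  hIter-tiled : ∀ d → Tiled (hIter (d + t))
  hIter-tiled d = subst Tiled (sym (trans (hIter≡A++b^ (d + t)) (cong (A (d + t) ++_) (sym (++-identityʳ _)))))
                        (tiled-A++b^ d (m≤n+m t d) [])

  IsW : ℕ → List Letter → Set
  IsW n w = ∃₂ λ p q → p + t + q ≡ n × w ≡ W p q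

  IsW-resp : ∀ {n w w′} → w ≡ w′ → (longestBRun w′ ≡ t → IsW n w′) → longestBRun w ≡ t → IsW n w
  IsW-resp refl f = f

  IsW-b^ : ∀ {n} → longestBRun (b^ n) ≡ t → IsW n (b^ n)
  IsW-b^ {n} run≡t = 0 , 0 , trans (+-identityʳ t) (sym n≡t) , trans (cong b^_ n≡t) (sym W-0-0)
    where
    W-0-0 : W 0 0 ≡ b^ t
    W-0-0 = trans (W-p-0 0) (cong (_++ b^ t) suffixA-0)
    n≡t : n ≡ t
    n≡t = trans (sym (longestBRun-b^ n)) run≡t

  IsW-take-b^++At : ∀ {n} g → n ≤ g + L → longestBRun (take n (b^ g ++ A t)) ≡ t → IsW n (take n (b^ g ++ A t))
  IsW-take-b^++At {n} g n≤ run≡t with ≤⊎≥ n g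
  ... | inj₁ n≤g rewrite take-b^ (A t) n≤g = IsW-b^ run≡t
  ... | inj₂ (k , refl) =
    0 , k , cong (_+ k) (sym g≡t) , trans window≡ (trans (cong (λ x → b^ x ++ prefixA k) g≡t) (sym (W-0-q k)))
    where
    k≤L : k ≤ L
    k≤L = +-cancelˡ-≤ g k L n≤
    window≡ : take (g + k) (b^ g ++ A t) ≡ b^ g ++ prefixA k
    window≡ = trans (take-b^-++ g k (A t)) (cong (b^ g ++_) (sym (prefixA-≤ k≤L)))
    g≡t : g ≡ t
    g≡t = ⊔≡⇒≡ˡ (trans (sym (longestBRun-b^-++ g (prefixA-leftClosed k)))
                       (trans (cong longestBRun (sym window≡)) run≡t))
                (s≤s (longestBRun-prefixA-≤L k≤L))

  IsW-take-suffixA : ∀ {n d} → n ≤ d → longestBRun (take n (suffixA d)) ≡ t → IsW n (take n (suffixA d))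
  IsW-take-suffixA {n} {d} n≤d run≡t with ≤⊎≥ d L
  ... | inj₁ d≤L = ⊥-elim (≡t⇒≰s run≡t
                    (≤-trans (longestBRun-take n (suffixA d)) (longestBRun-suffixA (≤-trans d≤L (m≤m+n L s)))))
  ... | inj₂ (g , refl) rewrite suffixA-+ g = IsW-take-b^++At g (≤-trans n≤d (≤-reflexive (+-comm L g))) run≡t

  -- If the b-run of length t is not the trailing b^k, it lies in suffixA d, which is then b^t A t.
  IsW-suffixA++b^ : ∀ d k → longestBRun (suffixA d ++ b^ k) ≡ t → IsW (d + k) (suffixA d ++ b^ k)
  IsW-suffixA++b^ d k run≡t with k ≟ t
  ... | yes refl = d , 0 , +-identityʳ (d + t) , sym (W-p-0 d)
  ... | no k≢t with longestBRun-suffixA≡t (⊔≡⇒≡ˡ run⊔k≡t k<t)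
    where
    run⊔k≡t : longestBRun (suffixA d) ⊔ k ≡ t
    run⊔k≡t = trans (sym (longestBRun-++-b^ k (suffixA-rightClosed d))) run≡t
    k<t : k < t
    k<t = ≤∧≢⇒< (≤-trans (m≤n⊔m (longestBRun (suffixA d)) k) (≤-reflexive run⊔k≡t)) k≢t
  ... | refl = 0 , L + k , trans (sym (+-assoc t L k)) (cong (_+ k) (+-comm t L)) , (begin
    suffixA (L + t) ++ b^ k   ≡⟨ cong (_++ b^ k) (suffixA-+ t) ⟩
    (b^ t ++ A t) ++ b^ k     ≡⟨ ++-assoc (b^ t) (A t) (b^ k) ⟩
    b^ t ++ A t ++ b^ k       ≡⟨ cong (b^ t ++_) (prefixA-+ k) ⟨
    b^ t ++ prefixA (L + k)   ≡⟨ W-0-q (L + k) ⟨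
    W 0 (L + k)               ∎)
    where open ≡-Reasoning

  IsW-suffixA++b^++prefixA : ∀ d {c} m → t ≤ c → longestBRun (suffixA d ++ b^ c ++ prefixA m) ≡ t →
                             IsW (d + (c + m)) (suffixA d ++ b^ c ++ prefixA m)
  IsW-suffixA++b^++prefixA d {c} m t≤c run≡t =
    d , m , trans (+-assoc d t m) (cong (λ x → d + (x + m)) (sym c≡t)) ,
    cong (λ x → suffixA d ++ b^ x ++ prefixA m) c≡t
    where
    c≤t : c ≤ t
    c≤t = begin
      c                                                          ≤⟨ m≤m⊔n c _ ⟩
      c ⊔ longestBRun (prefixA m)                                ≤⟨ m≤n⊔m (longestBRun (suffixA d)) _ ⟩
      longestBRun (suffixA d) ⊔ (c ⊔ longestBRun (prefixA m))    ≡⟨ cong (longestBRun (suffixA d) ⊔_)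
                                                                       (longestBRun-b^-++ c (prefixA-leftClosed m)) ⟨
      longestBRun (suffixA d) ⊔ longestBRun (b^ c ++ prefixA m)  ≡⟨ longestBRun-++ʳ _ (suffixA-rightClosed d) ⟨
      longestBRun (suffixA d ++ b^ c ++ prefixA m)               ≡⟨ run≡t ⟩
      t                                                          ∎
      where open ≤-Reasoning
    c≡t : c ≡ t
    c≡t = ≤-antisym c≤t t≤c

  take-tiled : ∀ {m X} → Tiled X → m ≤ length X → m ≤ L + t → take m X ≡ prefixA m
  take-tiled []                  z≤n _  = sym prefixA-0
  take-tiled (tile {X = X} t≤c _) _  m≤ = take-At++b^ X (≤-trans m≤ (+-monoʳ-≤ L t≤c))

  IsW-straddle : ∀ {n d c X} → n ≤ L + s + t → t ≤ c → Tiled X → n ≤ d + (c + length X) →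
                 longestBRun (take n (suffixA d ++ b^ c ++ X)) ≡ t → IsW n (take n (suffixA d ++ b^ c ++ X))
  IsW-straddle {n} {d} {c} {X} bound t≤c tX n≤ run≡t with ≤⊎≥ n d
  ... | inj₁ n≤d rewrite take-++-≤ n (suffixA d) (b^ c ++ X) (subst (n ≤_) (sym (length-suffixA d)) n≤d) =
    IsW-take-suffixA n≤d run≡t
  ... | inj₂ (k , refl) rewrite take-suffixA-++ d k (b^ c ++ X) =
    straddle-separator k bound (+-cancelˡ-≤ d k _ n≤) run≡t
    where
    straddle-separator : ∀ k → d + k ≤ L + s + t → k ≤ c + length X →
                         longestBRun (suffixA d ++ take k (b^ c ++ X)) ≡ t →
                         IsW (d + k) (suffixA d ++ take k (b^ c ++ X))
    straddle-separator k d+k≤ k≤ run≡t with ≤⊎≥ k c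
    ... | inj₁ k≤c rewrite take-b^ X k≤c = IsW-suffixA++b^ d k run≡t
    ... | inj₂ (m , refl) = IsW-resp window≡ (IsW-suffixA++b^++prefixA d m t≤c) run≡t
      where
      m≤L+t : m ≤ L + t
      m≤L+t = ≤-trans (+-cancelʳ-≤ t m (L + s) (≤-trans (≤-reflexive (+-comm m t))
                (≤-trans (+-monoˡ-≤ m t≤c) (≤-trans (m≤n+m (c + m) d) d+k≤))))
              (+-monoʳ-≤ L (n≤1+n s))
      window≡ : suffixA d ++ take (c + m) (b^ c ++ X) ≡ suffixA d ++ b^ c ++ prefixA m
      window≡ = cong (suffixA d ++_)
                  (trans (take-b^-++ c m X) (cong (b^ c ++_) (take-tiled tX (+-cancelˡ-≤ c m _ k≤) m≤L+t)))

  length-tile : ∀ c X → length (A t ++ b^ c ++ X) ≡ L + (c + length X)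
  length-tile c X = trans (length-++ (A t))
                          (cong (L +_) (trans (length-++ (b^ c)) (cong (_+ length X) (length-b^ c))))

  -- b^ g is the end of the separator preceding X; the window starts i letters into b^ g ++ X.
  IsW-window : ∀ {n X} → n ≤ L + s + t → Tiled X → ∀ g i → i + n ≤ g + length X →
               longestBRun (take n (drop i (b^ g ++ X))) ≡ t → IsW n (take n (drop i (b^ g ++ X)))
  IsW-window bound [] g i i+n≤ =
    IsW-resp (take-drop-b^ [] (≤-trans i+n≤ (≤-reflexive (+-identityʳ g)))) IsW-b^
  IsW-window {n} bound (tile {c} {X} t≤c tX) g i i+n≤ run≡t with ≤⊎≥ i (g + L)
  ... | inj₁ i≤ rewrite drop-b^++At++ g (b^ c ++ X) i≤ = IsW-straddle bound t≤c tX n≤ run≡t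
    where
    n≤ : n ≤ (g + L ∸ i) + (c + length X)
    n≤ = begin
      n
        ≡⟨ m+n∸m≡n i n ⟨
      i + n ∸ i
        ≤⟨ ∸-monoˡ-≤ i (≤-trans i+n≤ (≤-reflexive (trans (cong (g +_) (length-tile c X)) (sym (+-assoc g L _))))) ⟩
      g + L + (c + length X) ∸ i
        ≡⟨ +-∸-comm (c + length X) i≤ ⟩
      (g + L ∸ i) + (c + length X) ∎
      where open ≤-Reasoning
  ... | inj₂ (k , refl) = IsW-resp (cong (take n) drop-past) (IsW-window bound tX c k k+n≤) run≡t
    where
    drop-past : drop (g + L + k) (b^ g ++ A t ++ b^ c ++ X) ≡ drop k (b^ c ++ X)
    drop-past = trans (cong (λ x → drop x (b^ g ++ A t ++ b^ c ++ X)) (+-assoc g L k))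
                      (trans (drop-b^-++ g (L + k) _) (drop-length-++ k (A t) _))
    k+n≤ : k + n ≤ c + length X
    k+n≤ = +-cancelˡ-≤ (g + L) _ _ (begin
      g + L + (k + n)                ≡⟨ +-assoc (g + L) k n ⟨
      g + L + k + n                  ≤⟨ i+n≤ ⟩
      g + length (A t ++ b^ c ++ X)  ≡⟨ cong (g +_) (length-tile c X) ⟩
      g + (L + (c + length X))       ≡⟨ +-assoc g L _ ⟨
      g + L + (c + length X)         ∎)
      where open ≤-Reasoning

  Target⇒IsW : ∀ {n w} → n ≤ L + s + t → Target n t w → IsW n w
  Target⇒IsW {n} {w} bound (length≡n , (i , factor≡w) , run≡t) =
    IsW-resp (sym window≡w) (IsW-window bound (hIter-tiled (i + n)) 0 i i+n≤) run≡t
    where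
    K = i + n + t
    window≡w : take n (drop i (hIter K)) ≡ w
    window≡w = trans (sym (factorAt≡take-drop-hIter n (≤-trans (m≤m+n (i + n) t) (n≤1+n K))))
                     (trans (cong (factorAt i) (sym length≡n)) factor≡w)
    i+n≤ : i + n ≤ length (hIter K)
    i+n≤ = ≤-trans (m≤m+n (i + n) t) (≤-trans (n≤1+n K) (length-hIter K))

  W-list-entry : ∀ n → Fin (suc (n ∸ t)) → List Letter
  W-list-entry n i = W (toℕ i) (n ∸ t ∸ toℕ i)

  W-list : ℕ → List (List Letter)
  W-list n = tabulate (W-list-entry n)

  W-list-index : ∀ {n p} → t ≤ n → p ≤ n ∸ t → p + t + (n ∸ t ∸ p) ≡ n
  W-list-index {n} {p} t≤n p≤ = begin
    p + t + (n ∸ t ∸ p)     ≡⟨ cong (_+ (n ∸ t ∸ p)) (+-comm p t) ⟩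
    t + p + (n ∸ t ∸ p)     ≡⟨ +-assoc t p _ ⟩
    t + (p + (n ∸ t ∸ p))   ≡⟨ cong (t +_) (m+[n∸m]≡n p≤) ⟩
    t + (n ∸ t)             ≡⟨ m+[n∸m]≡n t≤n ⟩
    n                       ∎
    where open ≡-Reasoning

  ∈-W-list⇒Target : ∀ {n w} → t ≤ n → n ≤ L + s + t → w ∈ W-list n → Target n t w
  ∈-W-list⇒Target {n} t≤n bound w∈ with ∈-tabulate⁻ {f = W-list-entry n} w∈
  ... | i , refl = subst (λ m → Target m t (W-list-entry n i)) index≡
                         (Target-W {toℕ i} {n ∸ t ∸ toℕ i} (≤-trans (≤-reflexive index≡) bound))
    where index≡ = W-list-index t≤n (toℕ≤pred[n] i)

  Target⇒∈-W-list : ∀ {n w} → n ≤ L + s + t → Target n t w → w ∈ W-list n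
  Target⇒∈-W-list bound target with Target⇒IsW bound target
  ... | p , q , refl , refl =
    subst (_∈ W-list (p + t + q)) W≡ (∈-tabulate⁺ {f = W-list-entry (p + t + q)} (fromℕ< (s≤s p≤N)))
    where
    N = p + t + q ∸ t
    N≡p+q : N ≡ p + q
    N≡p+q = trans (cong (_∸ t) (trans (+-assoc p t q) (trans (cong (p +_) (+-comm t q)) (sym (+-assoc p q t)))))
                  (m+n∸n≡m (p + q) t)
    p≤N : p ≤ N
    p≤N = ≤-trans (m≤m+n p q) (≤-reflexive (sym N≡p+q))
    W≡ : W (toℕ (fromℕ< (s≤s p≤N))) (N ∸ toℕ (fromℕ< (s≤s p≤N))) ≡ W p q
    W≡ rewrite toℕ-fromℕ< (s≤s p≤N) | N≡p+q = cong (W p) (m+n∸m≡n p q)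

  W-list-unique : ∀ n → n ≤ L + s + t → Unique (W-list n)
  W-list-unique n bound =
    tabulate⁺ {f = W-list-entry n} (λ {i} {j} eq → toℕ-injective (W-injectiveˡ (index≤ i) (index≤ j) eq))
    where
    index≤ : ∀ (i : Fin (suc (n ∸ t))) → toℕ i ≤ L + s
    index≤ i = ≤-trans (toℕ≤pred[n] i) (≤-trans (∸-monoˡ-≤ t bound) (≤-reflexive (m+n∸n≡m (L + s) t)))

  length-W-list : ∀ {n} → t ≤ n → length (W-list n) ≡ suc n ∸ t
  length-W-list {n} t≤n = trans (length-tabulate (W-list-entry n)) (sym (+-∸-assoc 1 t≤n))

  FGraph⇒bound : ∀ {n j} → FGraph n j → j < t → n ≤ L + s + t
  FGraph⇒bound {n} {j} (_ , n≤) (s≤s j≤s) = begin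
    n                                ≤⟨ n≤ ⟩
    2 ^ (j + 2) + j ∸ 2              ≤⟨ ∸-monoˡ-≤ 2 (+-mono-≤ (^-monoʳ-≤ 2 (+-monoˡ-≤ 2 j≤s)) j≤s) ⟩
    2 ^ (s + 2) + s ∸ 2              ≡⟨ cong (λ x → 2 ^ x + s ∸ 2) (+-comm s 2) ⟩
    2 ^ suc t + s ∸ 2                ≡⟨ cong (λ x → x + s ∸ 2) (length-A t) ⟨
    L + suc t + s ∸ 2                ≡⟨ cong (_∸ 2) (regroup L s) ⟩
    L + s + s + 2 ∸ 2                ≡⟨ m+n∸n≡m (L + s + s) 2 ⟩
    L + s + s                        ≤⟨ +-monoʳ-≤ (L + s) (n≤1+n s) ⟩
    L + s + t                        ∎
    where
    open ≤-Reasoning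
    regroup : ∀ x y → x + suc (suc y) + y ≡ x + y + y + 2
    regroup = solve-∀

corollary10 : (n j : ℕ) → FGraph n j → (t : ℕ) → j < t → t ≤ n →
    Σ (List (List Letter)) λ ws →
      Unique ws × ((w : List Letter) → (w ∈ ws → Target n t w) × (Target n t w → w ∈ ws))
        × (length ws ≡ suc n ∸ t)
corollary10 n j fg zero    ()  t≤n
corollary10 n j fg (suc s) j<t t≤n =
  W-list n , W-list-unique n bound , (λ w → ∈-W-list⇒Target t≤n bound , Target⇒∈-W-list bound) , length-W-list t≤n
  where
  open FixedRunLength s
  bound : n ≤ L + s + t
  bound = FGraph⇒bound fg j<t
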